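{- Let $k\geq2$ and $r<\frac{(k-1)n}{k}$ be positive integers, let $\sigma=(\sigma(1),\dots,\sigma(n))$ be a cyclic order on $[n]$, and let $\mathcal{F}$ be a $k$-wise intersecting family of $\sigma$-intervals of length $r$. If $|\mathcal{F}|=r$, then there is a point $x$ such that $\mathcal{F}$ consists of all $\sigma$-intervals of length $r$ that contain $x$.
   Context: A cyclic order on $[n]=\{1,\dots,n\}$ is a permutation $\sigma$ of $[n]$, written as the sequence $(\sigma(1),\dots,\sigma(n))$, considered up to cyclic shifts (i.e. $\sigma$ and $\mu$ are equivalent if there is $i$ with $\pi(x)=\mu(x+i)$ for all $x$, addition mod $n$). A $\sigma$-interval of length $r$ is a set $\{\sigma(x),\sigma(x+1),\dots,\sigma(x+r-1)\}$ for some $x\in[n]$, with indices taken mod $n$ in $[n]$. A family is $k$-wise intersecting if any $k$ of its members have a common element. -}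

module Defs where

open import Data.Nat using (ℕ; zero; suc; _+_; _%_; NonZero)
open import Data.Nat.DivMod using (m%n<n)
open import Data.Fin using (Fin; toℕ; fromℕ<)
open import Data.Fin.Subset using (Subset; ⊥; ⁅_⁆; _∪_; _∈_)
open import Data.Fin.Permutation using (Permutation′; _⟨$⟩ʳ_)
open import Data.List using (List)
open import Data.List.Membership.Propositional renaming (_∈_ to _∈ₗ_)
open import Data.Product using (∃; _×_)
open import Relation.Binary.PropositionalEquality using (_≡_)

-- A cyclic order on [n] is represented by a permutation σ of Fin n
-- (positions 0..n-1 are the paper's positions 1..n). All notions below
-- (σ-intervals) are invariant under cyclic shift, so working with a
-- representative permutation is faithful.

_⊕_ : ∀ {n} .{{_ : NonZero n}} → Fin n → ℕ → Fin n
_⊕_ {n} x j = fromℕ< (m%n<n (toℕ x + j) n)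

interval : ∀ {n} .{{_ : NonZero n}} → Permutation′ n → ℕ → Fin n → Subset n
interval σ zero    x = ⊥
interval σ (suc j) x = interval σ j x ∪ ⁅ σ ⟨$⟩ʳ (x ⊕ j) ⁆

IsInterval : ∀ {n} .{{_ : NonZero n}} → Permutation′ n → ℕ → Subset n → Set
IsInterval σ r S = ∃ λ x → S ≡ interval σ r x

-- a family (list of sets) is k-wise intersecting: any k members
-- (not necessarily distinct) have a common element
KWiseIntersecting : ∀ {n} → ℕ → List (Subset n) → Set
KWiseIntersecting {n} k F =
  (G : Fin k → Subset n) → (∀ i → G i ∈ₗ F) → ∃ λ (y : Fin n) → ∀ i → y ∈ G i

-- Positions are natural numbers modulo n; position x is chosen when the σ-interval of length r
-- starting at x belongs to F. Exactly r positions are chosen, so exactly L = n − r are not, and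
-- the hypothesis on r says n < kL. The interval starting at g misses exactly g − L, …, g − 1, so
-- k-wise intersection forbids k chosen positions with all cyclic gaps at most L. From a chosen x,
-- the progression x, x + f, x + f + L, x + f + 2L, … (or the part of it after x, depending on f
-- versus n mod L) is such a chain of at most k positions, so it meets an unchosen position:
-- every class of offsets from x modulo L contains an unchosen one, and by counting exactly one.
-- If a is chosen and a + ℓ is not (ℓ < L), the chain a, a + ℓ + 1, a + ℓ + L, a + ℓ + 2L, …
-- then forces a + ℓ + 1 to be unchosen too. Hence the L unchosen positions form a block
-- a + 1, …, a + L after a chosen a, and F consists of the intervals containing σ(a).

module Submission where

open import Defs
open import Data.Bool using (Bool; true; false)
open import Data.Bool.Properties as Bool using (¬-not; not-¬)
open import Data.Empty using (⊥; ⊥-elim)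
open import Data.Nat
open import Data.Nat.DivMod
open import Data.Nat.Properties
open import Algebra.Properties.CommutativeSemigroup +-commutativeSemigroup using (x∙yz≈xz∙y; xy∙z≈xz∙y)
open import Data.Fin using (Fin; zero; suc; toℕ; fromℕ<; splitAt; join)
open import Data.Fin.Properties using (toℕ-fromℕ<; toℕ<n; toℕ-injective; join-splitAt; injective⇒≤)
open import Data.Fin.Permutation using (Permutation′; _⟨$⟩ʳ_; _⟨$⟩ˡ_; inverseˡ)
open import Data.Fin.Subset using (Subset; ⁅_⁆; _∈_)
open import Data.Fin.Subset.Properties using (x∈p∪q⁻; x∈p∪q⁺; x∈⁅y⁆⇒x≡y; x∈⁅x⁆; ∉⊥)
open import Data.List using (List; length; lookup)
open import Data.List.Membership.Propositional using () renaming (_∈_ to _∈ₗ_)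
open import Data.List.Membership.Propositional.Properties using (∈-lookup)
open import Data.List.Relation.Unary.All as All using (All)
open import Data.List.Relation.Unary.AllPairs using (_∷_)
open import Data.List.Relation.Unary.Unique.Propositional using (Unique)
open import Data.Product using (∃; _×_; _,_; proj₁; proj₂)
open import Data.Sum using (_⊎_; inj₁; inj₂)
open import Data.Vec.Properties using (≡-dec)
open import Function using (_∘_)
open import Function.Bundles using (_⇔_; mk⇔)
open import Relation.Binary.PropositionalEquality
open import Relation.Nullary using (yes; no; does)
open import Relation.Nullary.Decidable using (dec-true)

[m+n%o]%o≡[m+n]%o : ∀ m n o .{{_ : NonZero o}} → (m + n % o) % o ≡ (m + n) % o
[m+n%o]%o≡[m+n]%o m n o = begin
  (m + n % o) % o            ≡⟨ %-distribˡ-+ m (n % o) o ⟩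
  (m % o + n % o % o) % o    ≡⟨ cong (λ z → (m % o + z) % o) (m%n%n≡m%n n o) ⟩
  (m % o + n % o) % o        ≡⟨ %-distribˡ-+ m n o ⟨
  (m + n) % o                ∎
  where open ≡-Reasoning

[m%o+n]%o≡[m+n]%o : ∀ m n o .{{_ : NonZero o}} → (m % o + n) % o ≡ (m + n) % o
[m%o+n]%o≡[m+n]%o m n o = begin
  (m % o + n) % o   ≡⟨ cong (_% o) (+-comm (m % o) n) ⟩
  (n + m % o) % o   ≡⟨ [m+n%o]%o≡[m+n]%o n m o ⟩
  (n + m) % o       ≡⟨ cong (_% o) (+-comm n m) ⟩
  (m + n) % o       ∎
  where open ≡-Reasoning

+-cong-mod : ∀ {x y} z n .{{_ : NonZero n}} → x % n ≡ y % n → (x + z) % n ≡ (y + z) % n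
+-cong-mod {x} {y} z n e = begin
  (x + z) % n             ≡⟨ %-distribˡ-+ x z n ⟩
  (x % n + z % n) % n     ≡⟨ cong (λ t → (t + z % n) % n) e ⟩
  (y % n + z % n) % n     ≡⟨ %-distribˡ-+ y z n ⟨
  (y + z) % n             ∎
  where open ≡-Reasoning

+-inverse-mod : ∀ x z n .{{_ : NonZero n}} → (x + z + (n ∸ z % n)) % n ≡ x % n
+-inverse-mod x z n = begin
  (x + z + (n ∸ z % n)) % n    ≡⟨ cong (_% n) (+-assoc x z (n ∸ z % n)) ⟩
  (x + (z + (n ∸ z % n))) % n  ≡⟨ cong (λ t → (x + t) % n) z+[n∸z%n]≡[1+z/n]*n ⟩
  (x + suc (z / n) * n) % n    ≡⟨ [m+kn]%n≡m%n x (suc (z / n)) n ⟩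
  x % n                        ∎
  where
  open ≡-Reasoning
  z+[n∸z%n]≡[1+z/n]*n : z + (n ∸ z % n) ≡ suc (z / n) * n
  z+[n∸z%n]≡[1+z/n]*n = begin
    z + (n ∸ z % n)                  ≡⟨ cong (_+ (n ∸ z % n)) (m≡m%n+[m/n]*n z n) ⟩
    z % n + z / n * n + (n ∸ z % n)  ≡⟨ xy∙z≈xz∙y (z % n) (z / n * n) (n ∸ z % n) ⟩
    z % n + (n ∸ z % n) + z / n * n  ≡⟨ cong (_+ z / n * n) (m+[n∸m]≡n (m%n≤n z n)) ⟩
    n + z / n * n                    ∎

+-cancelʳ-mod : ∀ {x y} z n .{{_ : NonZero n}} → (x + z) % n ≡ (y + z) % n → x % n ≡ y % n
+-cancelʳ-mod {x} {y} z n e = begin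
  x % n                       ≡⟨ +-inverse-mod x z n ⟨
  (x + z + (n ∸ z % n)) % n   ≡⟨ +-cong-mod (n ∸ z % n) n e ⟩
  (y + z + (n ∸ z % n)) % n   ≡⟨ +-inverse-mod y z n ⟩
  y % n                       ∎
  where open ≡-Reasoning

∃-offset : ∀ a b n .{{_ : NonZero n}} → ∃ λ o → o < n × (a + o) % n ≡ b % n
∃-offset a b n = (b + (n ∸ a % n)) % n , m%n<n _ n , (begin
  (a + (b + (n ∸ a % n)) % n) % n   ≡⟨ [m+n%o]%o≡[m+n]%o a (b + (n ∸ a % n)) n ⟩
  (a + (b + (n ∸ a % n))) % n       ≡⟨ cong (_% n) (trans (sym (+-assoc a b _)) (cong (_+ (n ∸ a % n)) (+-comm a b))) ⟩
  (b + a + (n ∸ a % n)) % n         ≡⟨ +-inverse-mod b a n ⟩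
  b % n                             ∎)
  where open ≡-Reasoning

offset-injective : ∀ a {o o′} n .{{_ : NonZero n}} → o < n → o′ < n →
                   (a + o) % n ≡ (a + o′) % n → o ≡ o′
offset-injective a {o} {o′} n o<n o′<n e = begin
  o        ≡⟨ m<n⇒m%n≡m o<n ⟨
  o % n    ≡⟨ +-cancelʳ-mod a n (subst₂ (λ u v → u % n ≡ v % n) (+-comm a o) (+-comm a o′) e) ⟩
  o′ % n   ≡⟨ m<n⇒m%n≡m o′<n ⟩
  o′       ∎
  where open ≡-Reasoning

step-back : ∀ {y t a} n .{{_ : NonZero n}} → t < n → (y + t) % n ≡ a % n → (suc a + (n ∸ suc t)) % n ≡ y % n
step-back {y} {t} {a} n t<n e = begin
  (suc a + (n ∸ suc t)) % n      ≡⟨ cong (_% n) (sym (+-suc a (n ∸ suc t))) ⟩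
  (a + suc (n ∸ suc t)) % n      ≡⟨ +-cong-mod (suc (n ∸ suc t)) n (sym e) ⟩
  (y + t + suc (n ∸ suc t)) % n  ≡⟨ cong (_% n) (trans (+-assoc y t _) (cong (y +_) (+-suc t (n ∸ suc t)))) ⟩
  (y + (suc t + (n ∸ suc t))) % n ≡⟨ cong (λ z → (y + z) % n) (m+[n∸m]≡n t<n) ⟩
  (y + n) % n                    ≡⟨ [m+n]%n≡m%n y n ⟩
  y % n                          ∎
  where open ≡-Reasoning

staircase : ∀ (E : ℕ → ℕ) L m {o} → (∀ j → j < m → E (suc j) ≤ E j + L) →
            E 0 ≤ o → o < E m + L → ∃ λ j → j ≤ m × E j ≤ o × o < E j + L
staircase E L zero    steps lo hi = 0 , z≤n , lo , hi
staircase E L (suc m) {o} steps lo hi with E (suc m) ≤? o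
... | yes E≤o = suc m , ≤-refl , E≤o , hi
... | no  E≰o with staircase E L m (λ j j<m → steps j (m<n⇒m<1+n j<m)) lo
                     (<-≤-trans (≰⇒> E≰o) (steps m ≤-refl))
...   | j , j≤m , rest = j , m≤n⇒m≤1+n j≤m , rest

module _ (n L : ℕ) .{{_ : NonZero n}} where

  -- The interval of length n ∸ L starting at g does not contain π.
  Misses : ℕ → ℕ → Set
  Misses g π = ∃ λ d → 1 ≤ d × d ≤ L × (π + d) % n ≡ g % n

  chain-covers : ∀ (E : ℕ → ℕ) m → (∀ j → j < m → E (suc j) ≤ E j + L) → E 0 + n ≤ E m + L →
                 ∀ x π → ∃ λ j → j ≤ m × Misses (x + E j) π
  chain-covers E m steps closes x π with ∃-offset (x + E 0) (π + L) n
  ... | o , o<n , x+E₀+o≡π+L with staircase E L m steps (m≤m+n (E 0) o)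
                                    (<-≤-trans (+-monoʳ-< (E 0) o<n) closes)
  ...   | j , j≤m , lo , hi = j , j≤m , d , 0<d , d≤L , +-cancelʳ-mod (E 0 + o) n shifted
    where
    d = E j + L ∸ (E 0 + o)
    0<d : 1 ≤ d
    0<d = m<n⇒0<n∸m hi
    d≤L : d ≤ L
    d≤L = subst (d ≤_) (m+n∸m≡n (E j) L) (∸-monoʳ-≤ (E j + L) lo)
    shifted : (π + d + (E 0 + o)) % n ≡ (x + E j + (E 0 + o)) % n
    shifted = begin
      (π + d + (E 0 + o)) % n      ≡⟨ cong (_% n) (trans (+-assoc π d (E 0 + o)) (cong (π +_) (m∸n+n≡m (<⇒≤ hi)))) ⟩
      (π + (E j + L)) % n          ≡⟨ cong (_% n) (x∙yz≈xz∙y π (E j) L) ⟩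
      (π + L + E j) % n            ≡⟨ +-cong-mod (E j) n (sym x+E₀+o≡π+L) ⟩
      (x + E 0 + o + E j) % n      ≡⟨ cong (λ t → (t + E j) % n) (+-assoc x (E 0) o) ⟩
      (x + (E 0 + o) + E j) % n    ≡⟨ cong (_% n) (xy∙z≈xz∙y x (E 0 + o) (E j)) ⟩
      (x + E j + (E 0 + o)) % n    ∎
      where open ≡-Reasoning

module Circle (n L k : ℕ) .{{_ : NonZero n}} .{{_ : NonZero L}} (L<n : L < n) (n<kL : n < k * L)
  (chosen : ℕ → Bool)
  (few-unchosen : (u : Fin (suc L) → ℕ) → (∀ i j → u i % n ≡ u j % n → i ≡ j) →
                  (∀ i → chosen (u i) ≡ false) → ⊥)
  (no-cover : (g : Fin k → ℕ) → (∀ i → chosen (g i) ≡ true) → (∀ π → ∃ λ i → Misses n L (g i) π) → ⊥)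
  where

  q s : ℕ
  q = n / L
  s = n % L

  n≡s+q*L : n ≡ s + q * L
  n≡s+q*L = m≡m%n+[m/n]*n n L

  s<L : s < L
  s<L = m%n<n n L

  q<k : q < k
  q<k = *-cancelʳ-< L q k (≤-<-trans (m/n*n≤m n L) n<kL)

  chain-has-unchosen : ∀ x (E : ℕ → ℕ) m → m < k → (∀ j → j < m → E (suc j) ≤ E j + L) →
                       E 0 + n ≤ E m + L → ∃ λ j → j ≤ m × chosen (x + E j) ≡ false
  chain-has-unchosen x E m m<k steps closes
    with anyUpTo? (λ j → chosen (x + E j) Bool.≟ false) (suc m)
  ... | yes (j , s≤s j≤m , unchosen) = j , j≤m , unchosen
  ... | no none = ⊥-elim (no-cover g chosen-g covers)
    where
    g : Fin k → ℕ
    g i = x + E (toℕ i ⊓ m)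
    chosen-g : ∀ i → chosen (g i) ≡ true
    chosen-g i = ¬-not (λ unchosen → none (toℕ i ⊓ m , s≤s (m⊓n≤n (toℕ i) m) , unchosen))
    covers : ∀ π → ∃ λ i → Misses n L (g i) π
    covers π with chain-covers n L E m steps closes x π
    ... | j , j≤m , misses = fromℕ< (≤-<-trans j≤m m<k) , subst (λ t → Misses n L (x + E t) π) index misses
      where
      index : j ≡ toℕ (fromℕ< (≤-<-trans j≤m m<k)) ⊓ m
      index = sym (trans (cong (_⊓ m) (toℕ-fromℕ< _)) (m≤n⇒m⊓n≡m j≤m))

  progression : ℕ → ℕ → ℕ → ℕ
  progression f f′ zero    = f′
  progression f f′ (suc j) = f + suc j * L

  progression-step : ∀ {f f′} → f ≤ f′ → ∀ j → progression f f′ (suc j) ≤ progression f f′ j + L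
  progression-step {f} {f′} f≤f′ zero = begin
    f + (L + 0) ≡⟨ cong (f +_) (+-identityʳ L) ⟩
    f + L       ≤⟨ +-monoˡ-≤ L f≤f′ ⟩
    f′ + L      ∎
    where open ≤-Reasoning
  progression-step {f} f≤f′ (suc j) = ≤-reflexive (x∙yz≈xz∙y f L (suc j * L))

  progression-≥ : ∀ {f f′} → f ≤ f′ → ∀ j → f + j * L ≤ progression f f′ j
  progression-≥ {f} f≤f′ zero    = subst (_≤ _) (sym (+-identityʳ f)) f≤f′
  progression-≥     f≤f′ (suc j) = ≤-refl

  M : ℕ → ℕ
  M f = (n ∸ suc f) / L

  module _ {f} (f<n : f < n) where

    private
      1+f+X≡n : suc f + (n ∸ suc f) ≡ n
      1+f+X≡n = m+[n∸m]≡n f<n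

    f+M*L<n : f + M f * L < n
    f+M*L<n = subst (f + M f * L <_) 1+f+X≡n (s≤s (+-monoʳ-≤ f (m/n*n≤m (n ∸ suc f) L)))

    n≤f+M*L+L : n ≤ f + M f * L + L
    n≤f+M*L+L = begin
      n                                 ≡⟨ 1+f+X≡n ⟨
      suc f + X                         ≡⟨ cong (suc f +_) (m≡m%n+[m/n]*n X L) ⟩
      suc f + (X % L + M f * L)         ≡⟨ +-suc f (X % L + M f * L) ⟨
      f + (suc (X % L) + M f * L)       ≤⟨ +-monoʳ-≤ f (+-monoˡ-≤ (M f * L) (m%n<n X L)) ⟩
      f + (L + M f * L)                 ≡⟨ x∙yz≈xz∙y f L (M f * L) ⟩
      f + M f * L + L                   ∎
      where
      open ≤-Reasoning
      X = n ∸ suc f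

    M<q : s ≤ f → M f < q
    M<q s≤f = m<n*o⇒m/o<n (+-cancelˡ-< s (n ∸ suc f) (q * L) (begin-strict
      s + (n ∸ suc f)      ≤⟨ +-monoˡ-≤ (n ∸ suc f) s≤f ⟩
      f + (n ∸ suc f)      <⟨ n<1+n _ ⟩
      suc f + (n ∸ suc f)  ≡⟨ 1+f+X≡n ⟩
      n                    ≡⟨ n≡s+q*L ⟩
      s + q * L            ∎))
      where open ≤-Reasoning

  module _ {x f f′} (chosen-x : chosen x ≡ true) (f≤f′ : f ≤ f′) (f′≤L : f′ ≤ L) where

    private
      f<n : f < n
      f<n = <-≤-trans (s≤s (≤-trans f≤f′ f′≤L)) L<n

    -- When s ≤ f the chain x, x + f′, x + f + L, …, x + f + M f * L has at most q + 1 ≤ k members.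
    unchosen-on-progression-≥s : s ≤ f →
      ∃ λ j → progression f f′ j < n × chosen (x + progression f f′ j) ≡ false
    unchosen-on-progression-≥s s≤f
      with chain-has-unchosen x E (suc (M f)) (≤-trans (s≤s (M<q f<n s≤f)) q<k) steps closes
      where
      E : ℕ → ℕ
      E zero    = 0
      E (suc j) = progression f f′ j
      steps : ∀ j → j < suc (M f) → E (suc j) ≤ E j + L
      steps zero    _ = f′≤L
      steps (suc j) _ = progression-step f≤f′ j
      closes : n ≤ progression f f′ (M f) + L
      closes = ≤-trans (n≤f+M*L+L f<n) (+-monoˡ-≤ L (progression-≥ f≤f′ (M f)))
    ... | zero , _ , unchosen =
      ⊥-elim (not-¬ chosen-x (subst (λ y → chosen y ≡ false) (+-identityʳ x) unchosen))
    ... | suc j , s≤s j≤M , unchosen = j , in-range j j≤M , unchosen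
      where
      in-range : ∀ j → j ≤ M f → progression f f′ j < n
      in-range zero    _   = <-≤-trans (s≤s f′≤L) L<n
      in-range (suc j) j≤M = ≤-<-trans (+-monoʳ-≤ f (*-monoˡ-≤ L j≤M)) (f+M*L<n f<n)

    -- When f < s the chain x + f′, x + f + L, …, x + f + q * L closes up without x itself.
    unchosen-on-progression-<s : f′ ≤ suc f → f < s →
      ∃ λ j → progression f f′ j < n × chosen (x + progression f f′ j) ≡ false
    unchosen-on-progression-<s f′≤1+f f<s
      with chain-has-unchosen x (progression f f′) q q<k (λ j _ → progression-step f≤f′ j) closes
      where
      closes : f′ + n ≤ progression f f′ q + L
      closes = begin
        f′ + n                 ≤⟨ +-monoˡ-≤ n f′≤1+f ⟩
        suc f + n              ≡⟨ cong (suc f +_) n≡s+q*L ⟩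
        suc f + (s + q * L)    ≡⟨ +-suc f (s + q * L) ⟨
        f + (suc s + q * L)    ≤⟨ +-monoʳ-≤ f (+-monoˡ-≤ (q * L) s<L) ⟩
        f + (L + q * L)        ≡⟨ x∙yz≈xz∙y f L (q * L) ⟩
        f + q * L + L          ≤⟨ +-monoˡ-≤ L (progression-≥ f≤f′ q) ⟩
        progression f f′ q + L ∎
        where open ≤-Reasoning
    ... | j , j≤q , unchosen = j , in-range j j≤q , unchosen
      where
      in-range : ∀ j → j ≤ q → progression f f′ j < n
      in-range zero    _   = <-≤-trans (s≤s f′≤L) L<n
      in-range (suc j) j≤q = begin-strict
        f + suc j * L  ≤⟨ +-monoʳ-≤ f (*-monoˡ-≤ L j≤q) ⟩
        f + q * L      <⟨ +-monoˡ-< (q * L) f<s ⟩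
        s + q * L      ≡⟨ n≡s+q*L ⟨
        n              ∎
        where open ≤-Reasoning

    unchosen-on-progression : f′ ≤ suc f →
      ∃ λ j → progression f f′ j < n × chosen (x + progression f f′ j) ≡ false
    unchosen-on-progression f′≤1+f with s ≤? f
    ... | yes s≤f = unchosen-on-progression-≥s s≤f
    ... | no  s≰f = unchosen-on-progression-<s f′≤1+f (≰⇒> s≰f)

  progression-diagonal : ∀ f j → progression f f j ≡ f + j * L
  progression-diagonal f zero    = sym (+-identityʳ f)
  progression-diagonal f (suc j) = refl

  unchosen-in-class : ∀ {x} f → chosen x ≡ true → f ≤ L →
    ∃ λ t → t < n × t % L ≡ f % L × chosen (x + t) ≡ false
  unchosen-in-class {x} f chosen-x f≤L with unchosen-on-progression chosen-x ≤-refl f≤L (n≤1+n f)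
  ... | j , in-range , unchosen rewrite progression-diagonal f j =
    f + j * L , in-range , [m+kn]%n≡m%n f j L , unchosen

  few-unchosen-offsets : ∀ x (o : Fin L → ℕ) o′ → (∀ i → o i < n) → o′ < n →
    (∀ {i j} → o i ≡ o j → i ≡ j) → (∀ i → o i ≢ o′) →
    (∀ i → chosen (x + o i) ≡ false) → chosen (x + o′) ≡ false → ⊥
  few-unchosen-offsets x o o′ o<n o′<n o-injective o≢o′ unchosen unchosen′ =
    few-unchosen (λ i → x + offsets i) distinct all-unchosen
    where
    offsets : Fin (suc L) → ℕ
    offsets zero    = o′
    offsets (suc i) = o i
    all-unchosen : ∀ i → chosen (x + offsets i) ≡ false
    all-unchosen zero    = unchosen′
    all-unchosen (suc i) = unchosen i
    below : ∀ i → offsets i < n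
    below zero    = o′<n
    below (suc i) = o<n i
    injective : ∀ i j → offsets i ≡ offsets j → i ≡ j
    injective zero    zero    _ = refl
    injective zero    (suc j) e = ⊥-elim (o≢o′ j (sym e))
    injective (suc i) zero    e = ⊥-elim (o≢o′ i e)
    injective (suc i) (suc j) e = cong suc (o-injective e)
    distinct : ∀ i j → (x + offsets i) % n ≡ (x + offsets j) % n → i ≡ j
    distinct i j e = injective i j (offset-injective x n (below i) (below j) e)

  -- Taking an unchosen offset from every class of offsets mod L, with t itself for its own class,
  -- plus t′ would give L + 1 unchosen positions.
  unique-in-class : ∀ {x t t′} → chosen x ≡ true → t < n → t′ < n → t % L ≡ t′ % L →
    chosen (x + t) ≡ false → chosen (x + t′) ≡ false → t ≡ t′
  unique-in-class {x} {t} {t′} chosen-x t<n t′<n same-class unchosen unchosen′ with t ≟ t′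
  ... | yes t≡t′ = t≡t′
  ... | no  t≢t′ = ⊥-elim (few-unchosen-offsets x (offset ∘ rep) t′ (offset<n ∘ rep) t′<n o-injective o≢t′
                             (unchosen-offset ∘ rep) unchosen′)
    where
    class : Fin L → ℕ
    class i = suc (toℕ i) % L

    record Representative (i : Fin L) : Set where
      field
        offset          : ℕ
        offset<n        : offset < n
        offset∈class    : offset % L ≡ class i
        unchosen-offset : chosen (x + offset) ≡ false
        t-preferred     : t % L ≡ class i → offset ≡ t
    open Representative

    rep : ∀ i → Representative i
    rep i with t % L ≟ class i
    ... | yes t∈i = record { offset = t ; offset<n = t<n ; offset∈class = t∈i
                           ; unchosen-offset = unchosen ; t-preferred = λ _ → refl }
    ... | no  t∉i with unchosen-in-class (suc (toℕ i)) chosen-x (toℕ<n i)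
    ...   | o , o<n , o∈i , unchosen-o = record { offset = o ; offset<n = o<n ; offset∈class = o∈i
                                                    ; unchosen-offset = unchosen-o ; t-preferred = ⊥-elim ∘ t∉i }

    o-injective : ∀ {i j} → offset (rep i) ≡ offset (rep j) → i ≡ j
    o-injective {i} {j} e = toℕ-injective (offset-injective 1 L (toℕ<n i) (toℕ<n j)
      (trans (sym (offset∈class (rep i))) (trans (cong (_% L) e) (offset∈class (rep j)))))

    o≢t′ : ∀ i → offset (rep i) ≢ t′
    o≢t′ i e = t≢t′ (trans (sym (t-preferred (rep i) t∈i)) e)
      where
      t∈i : t % L ≡ class i
      t∈i = trans same-class (trans (cong (_% L) (sym e)) (offset∈class (rep i)))

  -- The chain a, a + ℓ + 1, a + ℓ + L, a + ℓ + 2L, … must hit an unchosen position, and the class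
  -- of ℓ + j * L mod L is already taken by the unchosen a + ℓ.
  unchosen-spreads : ∀ {a ℓ} → chosen a ≡ true → ℓ < L →
                     chosen (a + ℓ) ≡ false → chosen (a + suc ℓ) ≡ false
  unchosen-spreads {a} {ℓ} chosen-a ℓ<L unchosen-ℓ = ¬-not next-not-chosen
    where
    next-not-chosen : chosen (a + suc ℓ) ≢ true
    next-not-chosen chosen-next with unchosen-on-progression chosen-a (n≤1+n ℓ) ℓ<L ≤-refl
    ... | zero  , _        , unchosen = not-¬ chosen-next unchosen
    ... | suc j , in-range , unchosen =
      <-irrefl (unique-in-class chosen-a (<-trans ℓ<L L<n) in-range
                  (sym ([m+kn]%n≡m%n ℓ (suc j) L)) unchosen-ℓ unchosen)
               (m<m+n ℓ (<-≤-trans (>-nonZero⁻¹ L) (m≤m+n L (j * L))))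

  unchosen-run : ∀ {a} → chosen a ≡ true → chosen (suc a) ≡ false →
                 ∀ j → j < L → chosen (suc a + j) ≡ false
  unchosen-run {a} chosen-a unchosen-1 zero    _     =
    subst (λ y → chosen y ≡ false) (sym (+-identityʳ (suc a))) unchosen-1
  unchosen-run {a} chosen-a unchosen-1 (suc j) 1+j<L =
    subst (λ y → chosen y ≡ false) (+-suc a (suc j)) (unchosen-spreads chosen-a 1+j<L
      (subst (λ y → chosen y ≡ false) (sym (+-suc a j)) (unchosen-run chosen-a unchosen-1 j (<-trans (n<1+n j) 1+j<L))))

  chosen-boundary : ∀ {x} t → chosen x ≡ true → chosen (x + t) ≡ false →
                    ∃ λ a → chosen a ≡ true × chosen (suc a) ≡ false
  chosen-boundary {x} zero chosen-x unchosen rewrite +-identityʳ x = ⊥-elim (not-¬ chosen-x unchosen)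
  chosen-boundary {x} (suc t) chosen-x unchosen with chosen (x + t) in chosen-t
  ... | true  = x + t , chosen-t , subst (λ y → chosen y ≡ false) (+-suc x t) unchosen
  ... | false = chosen-boundary t chosen-x chosen-t

  unchosen-block : ∀ {x} → chosen x ≡ true → ∃ λ a → ∀ j → j < L → chosen (suc a + j) ≡ false
  unchosen-block {x} chosen-x with unchosen-in-class 0 chosen-x z≤n
  ... | t , _ , _ , unchosen with chosen-boundary t chosen-x unchosen
  ...   | a , chosen-a , unchosen-1 = a , unchosen-run chosen-a unchosen-1

k*r<[k∸1]*n⇒r<n×n<k*[n∸r] : ∀ k {r n} → k * r < (k ∸ 1) * n → r < n × n < k * (n ∸ r)
k*r<[k∸1]*n⇒r<n×n<k*[n∸r] (suc k) {r} {n} hyp = r<n , n<kL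
  where
  r<n : r < n
  r<n with r <? n
  ... | yes r<n = r<n
  ... | no  r≮n = ⊥-elim (<-irrefl refl (begin-strict
    k * n        ≤⟨ *-monoʳ-≤ k (≮⇒≥ r≮n) ⟩
    k * r        ≤⟨ m≤n+m (k * r) r ⟩
    r + k * r    <⟨ hyp ⟩
    k * n        ∎))
    where open ≤-Reasoning
  L = n ∸ r
  n≡r+L : n ≡ r + L
  n≡r+L = sym (m+[n∸m]≡n (<⇒≤ r<n))
  r<k*L : r < k * L
  r<k*L = +-cancelˡ-< (k * r) r (k * L) (begin-strict
    k * r + r      ≡⟨ +-comm (k * r) r ⟩
    r + k * r      <⟨ hyp ⟩
    k * n          ≡⟨ cong (k *_) n≡r+L ⟩
    k * (r + L)    ≡⟨ *-distribˡ-+ k r L ⟩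
    k * r + k * L  ∎)
    where open ≤-Reasoning
  n<kL : n < suc k * L
  n<kL = begin-strict
    n          ≡⟨ n≡r+L ⟩
    r + L      <⟨ +-monoˡ-< L r<k*L ⟩
    k * L + L  ≡⟨ +-comm (k * L) L ⟩
    suc k * L  ∎
    where open ≤-Reasoning

Unique⇒lookup-injective : ∀ {A : Set} {xs : List A} → Unique xs → ∀ i j → lookup xs i ≡ lookup xs j → i ≡ j
Unique⇒lookup-injective (_  ∷ u) zero    zero    _ = refl
Unique⇒lookup-injective (x∉ ∷ _) zero    (suc j) e = ⊥-elim (All.lookup x∉ (∈-lookup j) e)
Unique⇒lookup-injective (x∉ ∷ _) (suc i) zero    e = ⊥-elim (All.lookup x∉ (∈-lookup i) (sym e))
Unique⇒lookup-injective (_  ∷ u) (suc i) (suc j) e = cong suc (Unique⇒lookup-injective u i j e)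

module _ {n} .{{_ : NonZero n}} (σ : Permutation′ n) where

  ∈-interval⁻ : ∀ m x {z} → z ∈ interval σ m x → ∃ λ t → t < m × σ ⟨$⟩ʳ (x ⊕ t) ≡ z
  ∈-interval⁻ zero    x z∈∅ = ⊥-elim (∉⊥ z∈∅)
  ∈-interval⁻ (suc m) x z∈I with x∈p∪q⁻ (interval σ m x) ⁅ σ ⟨$⟩ʳ (x ⊕ m) ⁆ z∈I
  ... | inj₁ z∈I′ with ∈-interval⁻ m x z∈I′
  ...   | t , t<m , e = t , m<n⇒m<1+n t<m , e
  ∈-interval⁻ (suc m) x z∈I | inj₂ z∈⁅⁆ = m , ≤-refl , sym (x∈⁅y⁆⇒x≡y _ z∈⁅⁆)

  ∈-interval⁺ : ∀ m x {t} → t < m → σ ⟨$⟩ʳ (x ⊕ t) ∈ interval σ m x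
  ∈-interval⁺ (suc m) x {t} t<1+m with t <? m
  ... | yes t<m = x∈p∪q⁺ (inj₁ (∈-interval⁺ m x t<m))
  ... | no  t≮m = x∈p∪q⁺ {p = interval σ m x}
                    (inj₂ (subst (λ v → σ ⟨$⟩ʳ (x ⊕ v) ∈ ⁅ σ ⟨$⟩ʳ (x ⊕ m) ⁆) (sym t≡m) (x∈⁅x⁆ _)))
    where
    t≡m : t ≡ m
    t≡m = ≤-antisym (s≤s⁻¹ t<1+m) (≮⇒≥ t≮m)

module Family (n k r : ℕ) .{{_ : NonZero n}} (1≤r : 1 ≤ r) (r<n : r < n) (n<kL : n < k * (n ∸ r))
  (σ : Permutation′ n) (F : List (Subset n)) (unique : Unique F)
  (intervals : All (IsInterval σ r) F) (intersecting : KWiseIntersecting k F) (|F|≡r : length F ≡ r)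
  where

  L : ℕ
  L = n ∸ r

  instance
    L-nonZero : NonZero L
    L-nonZero = ≢-nonZero (m>n⇒m∸n≢0 r<n)

  r+L≡n : r + L ≡ n
  r+L≡n = m+[n∸m]≡n (<⇒≤ r<n)

  L<n : L < n
  L<n = subst (L <_) r+L≡n (m<n+m L 1≤r)

  pos : ℕ → Fin n
  pos x = fromℕ< (m%n<n x n)

  toℕ-pos : ∀ x → toℕ (pos x) ≡ x % n
  toℕ-pos x = toℕ-fromℕ< (m%n<n x n)

  pos-toℕ : ∀ y → pos (toℕ y) ≡ y
  pos-toℕ y = toℕ-injective (trans (toℕ-pos (toℕ y)) (m<n⇒m%n≡m (toℕ<n y)))

  pos-cong : ∀ {x y} → x % n ≡ y % n → pos x ≡ pos y
  pos-cong {x} {y} e = toℕ-injective (trans (toℕ-pos x) (trans e (sym (toℕ-pos y))))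

  toℕ-pos-⊕ : ∀ x t → toℕ (pos x ⊕ t) ≡ (x + t) % n
  toℕ-pos-⊕ x t = trans (toℕ-fromℕ< (m%n<n (toℕ (pos x) + t) n))
                        (trans (cong (λ z → (z + t) % n) (toℕ-pos x)) ([m%o+n]%o≡[m+n]%o x t n))

  open import Data.List.Membership.DecPropositional (≡-dec {n = n} Bool._≟_) using (_∈?_)

  chosen : ℕ → Bool
  chosen x = does (interval σ r (pos x) ∈? F)

  chosen⇒∈ : ∀ {x} → chosen x ≡ true → interval σ r (pos x) ∈ₗ F
  chosen⇒∈ {x} chosen-x with interval σ r (pos x) ∈? F
  ... | yes I∈F = I∈F
  ... | no  _   = ⊥-elim (not-¬ chosen-x refl)

  ∈⇒chosen : ∀ {x} → interval σ r (pos x) ∈ₗ F → chosen x ≡ true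
  ∈⇒chosen {x} = dec-true (interval σ r (pos x) ∈? F)

  start-chosen : ∀ {S} y → S ∈ₗ F → S ≡ interval σ r y → chosen (toℕ y) ≡ true
  start-chosen y S∈F S≡ = ∈⇒chosen (subst (_∈ₗ F) (trans S≡ (cong (interval σ r) (sym (pos-toℕ y)))) S∈F)

  chosen-cong : ∀ {x y} → x % n ≡ y % n → chosen x ≡ chosen y
  chosen-cong e = cong (λ p → does (interval σ r p ∈? F)) (pos-cong e)

  -- The r starts of members of F and L + 1 unchosen positions would be n + 1 distinct positions.
  few-unchosen : (u : Fin (suc L) → ℕ) → (∀ i j → u i % n ≡ u j % n → i ≡ j) →
                 (∀ i → chosen (u i) ≡ false) → ⊥
  few-unchosen u distinct unchosen = <-irrefl refl (begin-strict
    n                    ≡⟨ r+L≡n ⟨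
    r + L                ≡⟨ cong (_+ L) |F|≡r ⟨
    length F + L         <⟨ +-monoʳ-< (length F) (n<1+n L) ⟩
    length F + suc L     ≤⟨ injective⇒≤ (λ {i} {j} → position∘split-injective i j) ⟩
    n                    ∎)
    where
    open ≤-Reasoning
    start-of : Fin (length F) → Fin n
    start-of a = proj₁ (All.lookup intervals (∈-lookup a))
    lookup≡ : ∀ a → lookup F a ≡ interval σ r (start-of a)
    lookup≡ a = proj₂ (All.lookup intervals (∈-lookup a))
    position : Fin (length F) ⊎ Fin (suc L) → Fin n
    position (inj₁ a) = start-of a
    position (inj₂ i) = pos (u i)
    member≢unchosen : ∀ a i → start-of a ≢ pos (u i)
    member≢unchosen a i e = not-¬ (∈⇒chosen (subst (_∈ₗ F) (trans (lookup≡ a) (cong (interval σ r) e)) (∈-lookup a))) (unchosen i)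
    position-injective : ∀ p p′ → position p ≡ position p′ → p ≡ p′
    position-injective (inj₁ a) (inj₁ b) e = cong inj₁ (Unique⇒lookup-injective unique a b
                                               (trans (lookup≡ a) (trans (cong (interval σ r) e) (sym (lookup≡ b)))))
    position-injective (inj₁ a) (inj₂ j) e = ⊥-elim (member≢unchosen a j e)
    position-injective (inj₂ i) (inj₁ b) e = ⊥-elim (member≢unchosen b i (sym e))
    position-injective (inj₂ i) (inj₂ j) e = cong inj₂ (distinct i j
                                               (trans (sym (toℕ-pos (u i))) (trans (cong toℕ e) (toℕ-pos (u j)))))
    position∘split-injective : ∀ i j → position (splitAt (length F) i) ≡ position (splitAt (length F) j) → i ≡ j
    position∘split-injective i j e =
      trans (sym (join-splitAt (length F) (suc L) i))
            (trans (cong (join (length F) (suc L)) (position-injective (splitAt (length F) i) (splitAt (length F) j) e)) (join-splitAt (length F) (suc L) j))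

  no-cover : (g : Fin k → ℕ) → (∀ i → chosen (g i) ≡ true) → (∀ π → ∃ λ i → Misses n L (g i) π) → ⊥
  no-cover g chosen-g covers
    with intersecting (λ i → interval σ r (pos (g i))) (λ i → chosen⇒∈ (chosen-g i))
  ... | y , y∈all with covers (toℕ (σ ⟨$⟩ˡ y))
  ...   | i , d , 1≤d , d≤L , π+d≡g with ∈-interval⁻ σ r (pos (g i)) (y∈all i)
  ...     | t , t<r , σ[g+t]≡y = <-irrefl (sym d+t≡0) (≤-trans 1≤d (m≤m+n d t))
    where
    π = toℕ (σ ⟨$⟩ˡ y)
    g+t≡π : (g i + t) % n ≡ π
    g+t≡π = trans (sym (toℕ-pos-⊕ (g i) t)) (cong toℕ (trans (sym (inverseˡ σ)) (cong (σ ⟨$⟩ˡ_) σ[g+t]≡y)))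
    d+t<n : d + t < n
    d+t<n = subst (d + t <_) (trans (+-comm L r) r+L≡n) (+-mono-≤-< d≤L t<r)
    d+t≡0 : d + t ≡ 0
    d+t≡0 = offset-injective π n d+t<n (>-nonZero⁻¹ n) (begin
      (π + (d + t)) % n  ≡⟨ cong (_% n) (sym (+-assoc π d t)) ⟩
      (π + d + t) % n    ≡⟨ +-cong-mod t n π+d≡g ⟩
      (g i + t) % n      ≡⟨ g+t≡π ⟩
      π                  ≡⟨ m<n⇒m%n≡m (toℕ<n (σ ⟨$⟩ˡ y)) ⟨
      π % n              ≡⟨ cong (_% n) (+-identityʳ π) ⟨
      (π + 0) % n        ∎)
      where open ≡-Reasoning

  some-chosen : ∃ λ x → chosen x ≡ true
  some-chosen = toℕ (proj₁ first-interval) , start-chosen (proj₁ first-interval) (∈-lookup first) (proj₂ first-interval)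
    where
    first : Fin (length F)
    first = fromℕ< (subst (0 <_) (sym |F|≡r) 1≤r)
    first-interval : IsInterval σ r (lookup F first)
    first-interval = All.lookup intervals (∈-lookup first)

  open Circle n L k L<n n<kL chosen few-unchosen no-cover using (unchosen-block; few-unchosen-offsets)

  module _ (a : ℕ) (block : ∀ j → j < L → chosen (suc a + j) ≡ false) where

    member⇒∋a : ∀ {S} → S ∈ₗ F → IsInterval σ r S × σ ⟨$⟩ʳ pos a ∈ S
    member⇒∋a {S} S∈F with All.lookup intervals S∈F
    ... | y , S≡ with ∃-offset (toℕ y) a n
    ...   | t , t<n , y+t≡a = (y , S≡) , subst (σ ⟨$⟩ʳ pos a ∈_) (sym S≡)
                                           (subst (λ p → σ ⟨$⟩ʳ p ∈ interval σ r y) y⊕t≡a (∈-interval⁺ σ r y t<r))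
      where
      y⊕t≡a : y ⊕ t ≡ pos a
      y⊕t≡a = toℕ-injective (trans (toℕ-fromℕ< _) (trans y+t≡a (sym (toℕ-pos a))))
      t<r : t < r
      t<r with t <? r
      ... | yes t<r = t<r
      ... | no  t≮r = ⊥-elim (not-¬ (start-chosen y S∈F S≡)
                        (trans (sym (chosen-cong (step-back n t<n y+t≡a)))
                               (block (n ∸ suc t) (∸-monoʳ-< (s≤s (≮⇒≥ t≮r)) t<n))))

    ∋a⇒member : ∀ {S} → IsInterval σ r S → σ ⟨$⟩ʳ pos a ∈ S → S ∈ₗ F
    ∋a⇒member {S} (y , S≡) a∈S with ∈-interval⁻ σ r y (subst (σ ⟨$⟩ʳ pos a ∈_) S≡ a∈S)
    ... | t , t<r , σ[y⊕t]≡σ[a] with chosen (toℕ y) in chosen-y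
    ...   | true  = subst (_∈ₗ F) (trans (cong (interval σ r) (pos-toℕ y)) (sym S≡)) (chosen⇒∈ chosen-y)
    ...   | false = ⊥-elim (few-unchosen-offsets (suc a) toℕ (n ∸ suc t) (λ i → <-trans (toℕ<n i) L<n)
                             (∸-monoʳ-< z<s t<n) toℕ-injective window≢y (λ i → block (toℕ i) (toℕ<n i))
                             (trans (chosen-cong (step-back n t<n y+t≡a)) chosen-y))
      where
      t<n : t < n
      t<n = <-trans t<r r<n
      y+t≡a : (toℕ y + t) % n ≡ a % n
      y+t≡a = trans (sym (toℕ-fromℕ< _))
                    (trans (cong toℕ (trans (sym (inverseˡ σ)) (trans (cong (σ ⟨$⟩ˡ_) σ[y⊕t]≡σ[a]) (inverseˡ σ))))
                           (toℕ-pos a))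
      window≢y : ∀ i → toℕ i ≢ n ∸ suc t
      window≢y i e = <-irrefl e (<-≤-trans (toℕ<n i) (∸-monoʳ-≤ n t<r))

  star : ∃ λ (x : Fin n) → (S : Subset n) → (S ∈ₗ F ⇔ (IsInterval σ r S × x ∈ S))
  star = star-at (unchosen-block (proj₂ some-chosen))
    where
    star-at : (∃ λ a → ∀ j → j < L → chosen (suc a + j) ≡ false) →
              ∃ λ (x : Fin n) → (S : Subset n) → (S ∈ₗ F ⇔ (IsInterval σ r S × x ∈ S))
    star-at (a , block) = σ ⟨$⟩ʳ pos a , λ S → mk⇔ (member⇒∋a a block) (λ (I , a∈S) → ∋a⇒member a block I a∈S)

lemma2p2 : (n k r : ℕ) .{{_ : NonZero n}} → 2 ≤ k → 1 ≤ r → k * r < (k ∸ 1) * n →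
           (σ : Permutation′ n) → (F : List (Subset n)) → Unique F →
           All (IsInterval σ r) F → KWiseIntersecting k F → length F ≡ r →
           ∃ λ (x : Fin n) → (S : Subset n) → (S ∈ₗ F ⇔ (IsInterval σ r S × x ∈ S))
-- The hypothesis 2 ≤ k is implied by k * r < (k ∸ 1) * n.
lemma2p2 n k r _ 1≤r hyp σ F unique intervals intersecting |F|≡r =
  let r<n , n<kL = k*r<[k∸1]*n⇒r<n×n<k*[n∸r] k hyp
  in Family.star n k r 1≤r r<n n<kL σ F unique intervals intersecting |F|≡r
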